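{- Let $\sigma$ be a supersequence over a set $A$ of $n$ letters, with segmentation $\sigma_1,\dots,\sigma_n$. For every integer $k$ with $1\le k\le n$, if $a$ is the last element of $\sigma_k$, then the letter $a$ does not occur in $\sigma_k$ at any position before its last position.
   Context: A supersequence over $A$ is a finite sequence of letters of $A$ containing every permutation of $A$ as a (not necessarily contiguous) subsequence. For $1\le k\le n$, a $k$-perm is a sequence of $k$ distinct letters of $A$, and a sequence is $k$-complete (over $A$) if every $k$-perm is a subsequence of it. The segmentation of $\sigma$ is the list of consecutive substrings $\sigma_1,\dots,\sigma_n$ with $\sigma=\sigma_1\sigma_2\cdots\sigma_n$ such that for every $k$, the prefix $\sigma_1\cdots\sigma_k$ is the shortest prefix of $\sigma$ that is $k$-complete. -}

module Defs where

open import Data.Nat using (ℕ; _<_)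
open import Data.Fin using (Fin)
open import Data.List using (List; length; take; drop)
open import Data.List.Relation.Unary.Unique.Propositional using (Unique)
open import Data.List.Relation.Binary.Sublist.Propositional using (_⊆_)
open import Data.Product using (_×_)
open import Relation.Binary.PropositionalEquality using (_≡_)

KPerm : {n : ℕ} → ℕ → List (Fin n) → Set
KPerm k p = (length p ≡ k) × Unique p

KComplete : {n : ℕ} → ℕ → List (Fin n) → Set
KComplete {n} k σ = (p : List (Fin n)) → KPerm k p → p ⊆ σ

Supersequence : (n : ℕ) → List (Fin n) → Set
Supersequence n σ = KComplete n σ

ShortestCompletePrefix : {n : ℕ} → ℕ → List (Fin n) → ℕ → Set
ShortestCompletePrefix k σ m =
  KComplete k (take m σ) × ((m' : ℕ) → m' < m → KComplete k (take m' σ) → Data.Empty.⊥)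
  where import Data.Empty

-- For k = 1, the shortest 0-complete prefix is the empty one (m₁ = 0).
IsSegment : {n : ℕ} → List (Fin n) → ℕ → List (Fin n) → Set
IsSegment {n} σ k s =
  Data.Product.Σ ℕ λ m₁ → Data.Product.Σ ℕ λ m₂ →
    ShortestCompletePrefix (k Data.Nat.∸ 1) σ m₁ ×
    ShortestCompletePrefix k σ m₂ ×
    (s ≡ drop m₁ (take m₂ σ))
  where import Data.Product

{-# OPTIONS --safe #-}
module Submission where

-- Let P be the shortest (k-1)-complete prefix, so that P σ_k is the shortest k-complete one,
-- and write σ_k = pre a.  If a occurred in pre, then P pre would already be k-complete: a
-- k-perm embedded in P pre a either avoids the final a, or is q a for a (k-1)-perm q, which
-- embeds in P, while a can be matched inside pre.  This contradicts minimality.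

open import Defs
open import Data.Nat using (ℕ; zero; suc; _≤_; _<_; _∸_; z<s; s<s)
open import Data.Nat.Properties using (m≤n⇒m⊓n≡m; m+n∸n≡m; <⇒≤)
open import Data.Fin using (Fin)
open import Data.List using (List; []; _∷_; _++_; [_]; length; take; drop)
open import Data.List.Properties using (take-take; take++drop≡id; length-++; ++-assoc; ++-conicalʳ; ∷-injective)
open import Data.List.Membership.Propositional using (_∈_; _∉_)
open import Data.List.Relation.Binary.Sublist.Propositional using (_⊆_; []; _∷_; _∷ʳ_; from∈)
open import Data.List.Relation.Binary.Sublist.Propositional.Properties using (++⁺)
open import Data.List.Relation.Unary.All.Properties using (++⁻ˡ)
open import Data.List.Relation.Unary.AllPairs using ([]; _∷_)
open import Data.List.Relation.Unary.Unique.Propositional using (Unique)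
open import Data.Product using (∃; _×_; _,_)
open import Data.Sum using (_⊎_; inj₁; inj₂)
open import Function using (case_of_)
open import Relation.Nullary using (contradiction)
open import Relation.Binary.PropositionalEquality using (_≡_; _≢_; refl; sym; trans; cong; subst; module ≡-Reasoning)

private
  variable
    A : Set
    x : A
    ys : List A

⊆-++[x]⁻ : ∀ {p : List A} → p ⊆ ys ++ [ x ] → p ⊆ ys ⊎ ∃ λ q → p ≡ q ++ [ x ]
⊆-++[x]⁻ {ys = []}     (_ ∷ʳ [])   = inj₁ []
⊆-++[x]⁻ {ys = []}     (refl ∷ []) = inj₂ ([] , refl)
⊆-++[x]⁻ {ys = y ∷ ys} (.y ∷ʳ p⊆) with ⊆-++[x]⁻ p⊆
... | inj₁ p⊆ys        = inj₁ (y ∷ʳ p⊆ys)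
... | inj₂ (q , refl)  = inj₂ (q , refl)
⊆-++[x]⁻ {ys = y ∷ ys} (refl ∷ p⊆) with ⊆-++[x]⁻ p⊆
... | inj₁ p⊆ys        = inj₁ (refl ∷ p⊆ys)
... | inj₂ (q , refl)  = inj₂ (y ∷ q , refl)

Unique-++⁻ˡ : ∀ xs → Unique (xs ++ ys) → Unique xs
Unique-++⁻ˡ []       _           = []
Unique-++⁻ˡ (x ∷ xs) (x∉ ∷ uniq) = ++⁻ˡ xs x∉ ∷ Unique-++⁻ˡ xs uniq

drop-take-≢[]⇒< : ∀ m n (xs : List A) → drop m (take n xs) ≢ [] → m < n
drop-take-≢[]⇒< zero    zero    xs       ne = contradiction refl ne
drop-take-≢[]⇒< zero    (suc n) xs       ne = z<s
drop-take-≢[]⇒< (suc m) zero    xs       ne = contradiction refl ne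
drop-take-≢[]⇒< (suc m) (suc n) []       ne = contradiction refl ne
drop-take-≢[]⇒< (suc m) (suc n) (x ∷ xs) ne = s<s (drop-take-≢[]⇒< m n xs ne)

take++drop-take : ∀ {m n} (xs : List A) → m ≤ n → take m xs ++ drop m (take n xs) ≡ take n xs
take++drop-take {m = m} {n} xs m≤n = begin
  take m xs ++ drop m (take n xs)          ≡⟨ cong (_++ drop m (take n xs)) take-m≡ ⟩
  take m (take n xs) ++ drop m (take n xs) ≡⟨ take++drop≡id m (take n xs) ⟩
  take n xs                                ∎
  where
  open ≡-Reasoning
  take-m≡ : take m xs ≡ take m (take n xs)
  take-m≡ = sym (trans (take-take m n xs) (cong (λ i → take i xs) (m≤n⇒m⊓n≡m m≤n)))

drop-take≡++[x]⇒take≡ : ∀ m n (xs : List A) ys → drop m (take n xs) ≡ ys ++ [ x ] →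
  take n xs ≡ (take m xs ++ ys) ++ [ x ]
drop-take≡++[x]⇒take≡ {x = x} m n xs ys segment≡ = begin
  take n xs                          ≡⟨ sym (take++drop-take xs (<⇒≤ m<n)) ⟩
  take m xs ++ drop m (take n xs)    ≡⟨ cong (take m xs ++_) segment≡ ⟩
  take m xs ++ ys ++ [ x ]           ≡⟨ sym (++-assoc (take m xs) ys [ x ]) ⟩
  (take m xs ++ ys) ++ [ x ]         ∎
  where
  open ≡-Reasoning
  m<n : m < n
  m<n = drop-take-≢[]⇒< m n xs λ empty →
    case ++-conicalʳ ys [ x ] (trans (sym segment≡) empty) of λ ()

take≡++[x]⇒take-length : ∀ n (xs : List A) ys → take n xs ≡ ys ++ [ x ] →
  length ys < n × take (length ys) xs ≡ ys
take≡++[x]⇒take-length zero    xs       []       ()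
take≡++[x]⇒take-length zero    xs       (y ∷ ys) ()
take≡++[x]⇒take-length (suc n) []       []       ()
take≡++[x]⇒take-length (suc n) []       (y ∷ ys) ()
take≡++[x]⇒take-length (suc n) (z ∷ zs) []       _  = z<s , refl
take≡++[x]⇒take-length (suc n) (z ∷ zs) (y ∷ ys) eq with ∷-injective eq
... | refl , eq′ with take≡++[x]⇒take-length n zs ys eq′
...   | shorter , prefix = s<s shorter , cong (z ∷_) prefix

KPerm-init : ∀ {n k} {q : List (Fin n)} {a : Fin n} → KPerm k (q ++ [ a ]) → KPerm (k ∸ 1) q
KPerm-init {q = q} (len , uniq) =
  trans (sym (m+n∸n≡m (length q) 1)) (cong (_∸ 1) (trans (sym (length-++ q)) len)) ,
  Unique-++⁻ˡ q uniq

KComplete-init : ∀ {n k} {P pre : List (Fin n)} {a : Fin n} →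
  KComplete (k ∸ 1) P → a ∈ pre → KComplete k ((P ++ pre) ++ [ a ]) → KComplete k (P ++ pre)
KComplete-init P-complete a∈pre complete p p-perm with ⊆-++[x]⁻ (complete p p-perm)
... | inj₁ p⊆         = p⊆
... | inj₂ (q , refl) = ++⁺ (P-complete q (KPerm-init p-perm)) (from∈ a∈pre)

lemma2 : (n : ℕ) (σ : List (Fin n)) → Supersequence n σ →
    (k : ℕ) → 1 ≤ k → k ≤ n →
    (s : List (Fin n)) → IsSegment σ k s →
    (pre : List (Fin n)) (a : Fin n) → s ≡ pre ++ [ a ] →
    a ∉ pre
lemma2 n σ _ k _ _ s (m₁ , m₂ , (P-complete , _) , (T-complete , T-minimal) , refl) pre a s≡ a∈pre =
  let T≡ = drop-take≡++[x]⇒take≡ m₁ m₂ σ pre s≡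
      (shorter , prefix) = take≡++[x]⇒take-length m₂ σ (take m₁ σ ++ pre) T≡
  in T-minimal _ shorter (subst (KComplete k) (sym prefix)
       (KComplete-init P-complete a∈pre (subst (KComplete k) T≡ T-complete)))
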